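{- For every small free wedge whose boundaries lie in adjacent quadrants, there exists a finite deterministic automaton that explores it using two pebbles.
   Context: The oriented grid $\mathbb{Z}\times\mathbb{Z}$ is embedded in the plane (nodes at integer points, edges between nodes at distance 1); nodes are anonymous and every node has ports $N,E,S,W$ pointing North, East, South, West. Given two half-lines $H_1,H_2$ in the plane with a common origin $O$ (arbitrary real directions), let $W(H_1,H_2)$ be the closed region swept clockwise from $H_1$ to $H_2$ (half-lines included); the wedge is the subgraph of the grid induced by the grid nodes in $W(H_1,H_2)$. It is small if the clockwise angle from $H_1$ to $H_2$ is less than $\pi$. The boundaries lie in adjacent quadrants if the direction vectors of $H_1$ and $H_2$ both have nonzero coordinates and lie in two distinct open quadrants of the plane sharing a side. A wedge is free if all ports at all nodes of the grid are free (the agent moves in the whole grid unrestricted but must visit all nodes of the wedge); the origin $O$ is the starting node of the agent. The agent is a finite deterministic (Mealy) automaton carrying $p$ pebbles: at each step it sees whether a pebble lies on the current node and how many pebbles it carries; depending on its state and this input it moves through a port, possibly dropping a pebble on the empty current node (if it carries one) or picking up the pebble lying there, and changes state. It starts in its initial state with all $p$ pebbles, with no pebbles on the grid. The automaton explores the wedge if every node of the wedge is eventually visited. -}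

module Defs where

open import Data.Bool using (Bool; true; false; if_then_else_)
open import Data.Nat as ℕ using (ℕ; zero; suc)
open import Data.Fin using (Fin; zero; suc)
open import Data.Integer as ℤ using (ℤ; +_)
open import Data.Rational as ℚ using (ℚ; 0ℚ; _/_)
open import Data.Product using (Σ; ∃; _×_; _,_; proj₁; proj₂)
open import Data.Product.Properties using (≡-dec)
open import Data.Sum using (_⊎_)
open import Data.Empty using (⊥)
open import Relation.Nullary using (¬_; yes; no)
open import Relation.Binary.PropositionalEquality using (_≡_; _≢_)
open import Function using (_∘_)

-- Real numbers (two–sided Dedekind cuts on ℚ).
-- L q  means  q < x ;  U q  means  x < q.

record ℝ : Set₁ where
  field
    L : ℚ → Set
    U : ℚ → Set
    L-inhabited : ∃ L
    U-inhabited : ∃ U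
    L-downward  : ∀ {p q} → p ℚ.< q → L q → L p
    L-rounded   : ∀ {q} → L q → ∃ λ r → q ℚ.< r × L r
    U-upward    : ∀ {p q} → p ℚ.< q → U p → U q
    U-rounded   : ∀ {q} → U q → ∃ λ r → r ℚ.< q × U r
    disjoint    : ∀ {q} → ¬ (L q × U q)
    located     : ∀ {p q} → p ℚ.< q → L p ⊎ U q

open ℝ public

Positive : ℝ → Set
Positive x = L x 0ℚ

Negative : ℝ → Set
Negative x = U x 0ℚ

-- Rational interval arithmetic, used to express sign conditions on
-- polynomial expressions in real numbers.

record Interval : Set where
  constructor [_,_]
  field
    lo : ℚ
    hi : ℚ
open Interval public

const : ℚ → Interval
const q = [ q , q ]

_+ᴵ_ : Interval → Interval → Interval
[ a , b ] +ᴵ [ c , d ] = [ a ℚ.+ c , b ℚ.+ d ]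

-ᴵ_ : Interval → Interval
-ᴵ [ a , b ] = [ ℚ.- b , ℚ.- a ]

_-ᴵ_ : Interval → Interval → Interval
I -ᴵ J = I +ᴵ (-ᴵ J)

_*ᴵ_ : Interval → Interval → Interval
[ a , b ] *ᴵ [ c , d ] =
  [ ((a ℚ.* c) ℚ.⊓ (a ℚ.* d)) ℚ.⊓ ((b ℚ.* c) ℚ.⊓ (b ℚ.* d))
  , ((a ℚ.* c) ℚ.⊔ (a ℚ.* d)) ℚ.⊔ ((b ℚ.* c) ℚ.⊔ (b ℚ.* d)) ]

Encl : ℝ → Set
Encl x = Σ (ℚ × ℚ) λ pq → L x (proj₁ pq) × U x (proj₂ pq)

encl : ∀ {x} → Encl x → Interval
encl ((p , q) , _) = [ p , q ]

ℝ² : Set₁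
ℝ² = ℝ × ℝ

ℤ² : Set
ℤ² = ℤ × ℤ

IVec : Set
IVec = Interval × Interval

EnclVec : ℝ² → Set
EnclVec (a , b) = Encl a × Encl b

enclVec : ∀ {d} → EnclVec d → IVec
enclVec {a , b} (ea , eb) = encl {a} ea , encl {b} eb

ofℤ : ℤ → Interval
ofℤ z = const (z / 1)

pointVec : ℤ² → IVec
pointVec (x , y) = ofℤ x , ofℤ y

crossᴵ : IVec → IVec → Interval
crossᴵ (x₁ , y₁) (x₂ , y₂) = (x₁ *ᴵ y₂) -ᴵ (y₁ *ᴵ x₂)

dotᴵ : IVec → IVec → Interval
dotᴵ (x₁ , y₁) (x₂ , y₂) = (x₁ *ᴵ x₂) +ᴵ (y₁ *ᴵ y₂)

-- A real quantity X determined (through interval arithmetic) by two real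
-- vectors d₁ d₂ is given by a map f from enclosures to intervals.
-- X ≤ 0  iff  every enclosure yields a lower bound ≤ 0;
-- X < 0  iff  some enclosure yields an upper bound < 0; etc.
Expr : Set
Expr = IVec → IVec → Interval

module _ (d₁ d₂ : ℝ²) (f : Expr) where
  IsNonPos : Set
  IsNonPos = (e₁ : EnclVec d₁) (e₂ : EnclVec d₂) →
             lo (f (enclVec {d₁} e₁) (enclVec {d₂} e₂)) ℚ.≤ 0ℚ

  IsNonNeg : Set
  IsNonNeg = (e₁ : EnclVec d₁) (e₂ : EnclVec d₂) →
             0ℚ ℚ.≤ hi (f (enclVec {d₁} e₁) (enclVec {d₂} e₂))

  IsNeg : Set
  IsNeg = Σ (EnclVec d₁) λ e₁ → Σ (EnclVec d₂) λ e₂ →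
          hi (f (enclVec {d₁} e₁) (enclVec {d₂} e₂)) ℚ.< 0ℚ

  IsPos : Set
  IsPos = Σ (EnclVec d₁) λ e₁ → Σ (EnclVec d₂) λ e₂ →
          0ℚ ℚ.< lo (f (enclVec {d₁} e₁) (enclVec {d₂} e₂))

-- A half-line with origin O is given by its direction d : ℝ².
-- Clockwise angle θ from d₁ to d₂:  cross(d₁,d₂) = -|d₁||d₂| sin θ.
-- θ < π  iff  θ ∈ (0,π) (cross < 0)  or  θ = 0 (same direction:
-- cross = 0 and dot > 0).

Small : ℝ² → ℝ² → Set
Small d₁ d₂ =
  IsNeg d₁ d₂ crossᴵ
  ⊎ (IsNonPos d₁ d₂ crossᴵ × IsNonNeg d₁ d₂ crossᴵ × IsPos d₁ d₂ dotᴵ)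

-- Membership of grid node x in W(H₁,H₂) for a SMALL wedge with origin O:
-- with v = x - O:  cross(d₁,v) ≤ 0, cross(v,d₂) ≤ 0 and
-- (dot(d₁,v) ≥ 0 or dot(v,d₂) ≥ 0)  (the last clause only matters when θ = 0).
_-²_ : ℤ² → ℤ² → ℤ²
(a , b) -² (c , d) = (a ℤ.- c , b ℤ.- d)

InSmallWedge : ℤ² → ℝ² → ℝ² → ℤ² → Set
InSmallWedge O d₁ d₂ x =
  IsNonPos d₁ d₂ (λ e₁ _ → crossᴵ e₁ v)
  × IsNonPos d₁ d₂ (λ _ e₂ → crossᴵ v e₂)
  × (IsNonNeg d₁ d₂ (λ e₁ _ → dotᴵ e₁ v) ⊎ IsNonNeg d₁ d₂ (λ _ e₂ → dotᴵ v e₂))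
  where v = pointVec (x -² O)

-- Quadrants: a sign for each coordinate.
data Sgn : Set where
  plus minus : Sgn

HasSign : ℝ → Sgn → Set
HasSign x plus = Positive x
HasSign x minus = Negative x

InOpenQuadrant : ℝ² → Sgn → Sgn → Set
InOpenQuadrant (a , b) s t = HasSign a s × HasSign b t

AdjacentQuadrants : ℝ² → ℝ² → Set
AdjacentQuadrants d₁ d₂ =
  Σ Sgn λ s₁ → Σ Sgn λ t₁ → Σ Sgn λ s₂ → Σ Sgn λ t₂ →
    InOpenQuadrant d₁ s₁ t₁ × InOpenQuadrant d₂ s₂ t₂ ×
    ((s₁ ≡ s₂ × t₁ ≢ t₂) ⊎ (s₁ ≢ s₂ × t₁ ≡ t₂))

-- Agents: finite deterministic Mealy automata with p pebbles.

data Port : Set where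
  N E S W : Port

move : Port → ℤ² → ℤ²
move N (x , y) = x , y ℤ.+ + 1
move E (x , y) = x ℤ.+ + 1 , y
move S (x , y) = x , y ℤ.- + 1
move W (x , y) = x ℤ.- + 1 , y

data Action : Set where
  none drop pick : Action

record Automaton (p : ℕ) : Set where
  field
    nStates : ℕ
    initial : Fin nStates
    -- input: current state, whether a pebble lies on the current node,
    -- number of carried pebbles (0..p); output: port, pebble action, new state
    δ : Fin nStates → Bool → Fin (suc p) → Port × Action × Fin nStates

-- number of carried pebbles as an element of Fin (suc p) (saturating; the
-- carried count never exceeds p, so this is exact on reachable configurations)
clamp : (p : ℕ) → ℕ → Fin (suc p)
clamp p       zero    = zero
clamp zero    (suc k) = zero
clamp (suc p) (suc k) = suc (clamp p k)

module Run {p : ℕ} (A : Automaton p) where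
  open Automaton A

  record Config : Set where
    constructor config
    field
      state   : Fin nStates
      pos     : ℤ²
      pebbles : ℤ² → Bool   -- nodes holding a pebble (at most one each)
      carried : ℕ

  set : (ℤ² → Bool) → ℤ² → Bool → ℤ² → Bool
  set f x b y with ≡-dec ℤ._≟_ ℤ._≟_ x y
  ... | yes _ = b
  ... | no  _ = f y

  -- the pebble action happens at the current node, then the agent moves
  -- (in a free wedge every port is free, so every move succeeds)
  step : Config → Config
  step (config q x peb c) with δ q (peb x) (clamp p c)
  ... | (port , none , q') = config q' (move port x) peb c
  ... | (port , drop , q') with peb x | c
  ...   | false | suc c' = config q' (move port x) (set peb x true) c'
  ...   | _     | _      = config q' (move port x) peb c
  step (config q x peb c) | (port , pick , q') with peb x
  ...   | true  = config q' (move port x) (set peb x false) (suc c)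
  ...   | false = config q' (move port x) peb c

  start : ℤ² → Config
  start O = config initial O (λ _ → false) p

  run : ℤ² → ℕ → Config
  run O zero    = start O
  run O (suc k) = step (run O k)

  Visits : ℤ² → ℤ² → Set
  Visits O x = ∃ λ k → Config.pos (run O k) ≡ x

Explores : ∀ {p} → Automaton p → ℤ² → (ℤ² → Set) → Set
Explores A O P = ∀ x → P x → Run.Visits A O x

-- Rotating the grid by a multiple of a quarter turn, a clockwise pair of half-lines in adjacent
-- quadrants becomes one whose first half-line points into the open first quadrant and whose second
-- one points into the open fourth quadrant; the wedge between them then lies in the cone
-- |b| ≤ C a of frame coordinates (a , b), with C bounding the slopes of both half-lines through
-- rational enclosures of their directions.  Such a cone is swept column by column with two
-- pebbles marking the ends of the explored part of column a: the agent carries the upper pebble to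
-- column a + 1, C rows higher, walks down column a to the lower pebble, carries it to column a + 1,
-- C rows lower, and walks up column a + 1 between the two.  A counterclockwise pair of half-lines
-- in adjacent quadrants makes a clockwise angle larger than π, so it never bounds a small wedge.

module Submission where

open import Algebra.Definitions using (Selective)
open import Data.Bool using (Bool; true; false)
open import Data.Empty using (⊥; ⊥-elim)
open import Data.Fin using (Fin; zero; suc; fromℕ; inject₁; toℕ; splitAt; _↑ˡ_; _↑ʳ_)
import Data.Fin.Properties as Finₚ
open import Data.Integer as ℤ using (ℤ; +_; -[1+_]; 0ℤ)
import Data.Integer.Properties as ℤₚ
import Data.Integer.Solver as ℤSolver
open import Data.List using (List; []; _∷_)
open import Data.List.Relation.Unary.All using (All; []; _∷_)
open import Data.Nat as ℕ using (ℕ; zero; suc)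
import Data.Nat.Coprimality as Coprimality
open import Data.Nat.GeneralisedArithmetic using (fold; iterate; iterate-is-fold)
import Data.Nat.Properties as ℕₚ
open import Data.Product using (Σ; ∃; ∃₂; _×_; _,_; proj₁; proj₂)
open import Data.Product.Properties using (≡-dec; ,-injectiveˡ; ,-injectiveʳ)
open import Data.Rational as ℚ using (ℚ; 0ℚ; 1ℚ; mkℚ; _/_)
import Data.Rational.Properties as ℚₚ
import Data.Rational.Solver as ℚSolver
open import Data.Sum using (_⊎_; inj₁; inj₂)
open import Function using (_$_)
open import Relation.Binary.Definitions using (tri<; tri≈; tri>)
open import Relation.Binary.PropositionalEquality hiding ([_])
open import Relation.Nullary using (¬_; yes; no)

open import Defs

ι : ℤ → ℚ
ι z = z / 1

-- _/_ normalises, so ι z is the literal fraction z/1 only up to propositional equality.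
private
  ι-mkℚ : ∀ z → ι z ≡ mkℚ z 0 (Coprimality.sym (Coprimality.1-coprimeTo ℤ.∣ z ∣))
  ι-mkℚ z = ℚₚ.fromℚᵘ-toℚᵘ (mkℚ z 0 (Coprimality.sym (Coprimality.1-coprimeTo ℤ.∣ z ∣)))

ι-* : ∀ a b → ι (a ℤ.* b) ≡ ι a ℚ.* ι b
ι-* a b rewrite ι-mkℚ a | ι-mkℚ b = refl

ι-neg : ∀ a → ι (ℤ.- a) ≡ ℚ.- ι a
ι-neg a = begin
  ι (ℤ.- a)             ≡⟨ cong ι (sym (ℤₚ.-1*i≡-i a)) ⟩
  ι (-[1+ 0 ] ℤ.* a)    ≡⟨ ι-* -[1+ 0 ] a ⟩
  ℚ.- 1ℚ ℚ.* ι a        ≡⟨ sym (ℚₚ.neg-distribˡ-* 1ℚ (ι a)) ⟩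
  ℚ.- (1ℚ ℚ.* ι a)      ≡⟨ cong ℚ.-_ (ℚₚ.*-identityˡ (ι a)) ⟩
  ℚ.- ι a               ∎
  where open ≡-Reasoning

ι-mono-< : ∀ {a b} → a ℤ.< b → ι a ℚ.< ι b
ι-mono-< {a} {b} a<b rewrite ι-mkℚ a | ι-mkℚ b =
  ℚ.*<* (subst₂ ℤ._<_ (sym (ℤₚ.*-identityʳ a)) (sym (ℤₚ.*-identityʳ b)) a<b)

ι-mono-≤ : ∀ {a b} → a ℤ.≤ b → ι a ℚ.≤ ι b
ι-mono-≤ {a} {b} a≤b rewrite ι-mkℚ a | ι-mkℚ b =
  ℚ.*≤* (subst₂ ℤ._≤_ (sym (ℤₚ.*-identityʳ a)) (sym (ℤₚ.*-identityʳ b)) a≤b)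

ι-cancel-< : ∀ {a b} → ι a ℚ.< ι b → a ℤ.< b
ι-cancel-< {a} {b} ιa<ιb = ℤₚ.≰⇒> (λ b≤a → ℚₚ.<-irrefl refl (ℚₚ.<-≤-trans ιa<ιb (ι-mono-≤ b≤a)))

ι-cancel-≤ : ∀ {a b} → ι a ℚ.≤ ι b → a ℤ.≤ b
ι-cancel-≤ {a} {b} ιa≤ιb = ℤₚ.≮⇒≥ (λ b<a → ℚₚ.<-irrefl refl (ℚₚ.<-≤-trans (ι-mono-< b<a) ιa≤ιb))

ℚ² : Set
ℚ² = ℚ × ℚ

ι² : ℤ² → ℚ²
ι² (a , b) = ι a , ι b

cross : ℚ² → ℚ² → ℚ
cross (a , b) (c , d) = a ℚ.* d ℚ.- b ℚ.* c

turnʳ : ℚ² → ℚ²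
turnʳ (a , b) = b , ℚ.- a

turnˡ : ℤ² → ℤ²
turnˡ (a , b) = ℤ.- b , a

module _ where
  open ℚSolver.+-*-Solver

  cross-turnˡ-right : ∀ w u → cross w (ι² (turnˡ u)) ≡ cross (turnʳ w) (ι² u)
  cross-turnˡ-right (ξ , η) (a , b) rewrite ι-neg b =
    solve 4 (λ ξ η a b → ξ :* a :- η :* (:- b) := η :* b :- (:- ξ) :* a) refl ξ η (ι a) (ι b)

  cross-turnˡ-left : ∀ u w → cross (ι² (turnˡ u)) w ≡ cross (ι² u) (turnʳ w)
  cross-turnˡ-left (a , b) (ξ , η) rewrite ι-neg b =
    solve 4 (λ ξ η a b → (:- b) :* η :- a :* ξ := a :* (:- ξ) :- b :* η) refl ξ η (ι a) (ι b)

  cross-mirror : ∀ α β a b →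
                 cross (α , ℚ.- β) (ι² (a , ℤ.- b)) ≡ cross (ι² (a , b)) (α , β)
  cross-mirror α β a b rewrite ι-neg b =
    solve 4 (λ α β a b → α :* (:- b) :- (:- β) :* a := a :* β :- b :* α) refl α β (ι a) (ι b)

  sub-≤0⇒≤ : ∀ {p q} → p ℚ.- q ℚ.≤ 0ℚ → p ℚ.≤ q
  sub-≤0⇒≤ {p} {q} p-q≤0 =
    subst₂ ℚ._≤_ (solve 2 (λ p q → p :- q :+ q := p) refl p q) (ℚₚ.+-identityˡ q)
      (ℚₚ.+-monoˡ-≤ q p-q≤0)

cross-turnsˡ-right : ∀ k w u → cross w (ι² (fold u turnˡ k)) ≡ cross (iterate turnʳ w k) (ι² u)
cross-turnsˡ-right zero    w u = refl
cross-turnsˡ-right (suc k) w u =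
  trans (cross-turnˡ-right w (fold u turnˡ k)) (cross-turnsˡ-right k (turnʳ w) u)

cross-turnsˡ-left : ∀ k u w → cross (ι² (fold u turnˡ k)) w ≡ cross (ι² u) (iterate turnʳ w k)
cross-turnsˡ-left zero    u w = refl
cross-turnsˡ-left (suc k) u w =
  trans (cross-turnˡ-left (fold u turnˡ k) w) (cross-turnsˡ-left k u (turnʳ w))

negate : Sgn → Sgn
negate plus  = minus
negate minus = plus

_*ˢ_ : Sgn → Sgn → Sgn
plus  *ˢ t = t
minus *ˢ t = negate t

HasSignℚ : ℚ → Sgn → Set
HasSignℚ ξ plus  = 0ℚ ℚ.< ξ
HasSignℚ ξ minus = ξ ℚ.< 0ℚ

InQuadrantℚ : ℚ² → Sgn × Sgn → Set
InQuadrantℚ (ξ , η) (s , t) = HasSignℚ ξ s × HasSignℚ η t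

turnᵠ : Sgn × Sgn → Sgn × Sgn
turnᵠ (s , t) = t , negate s

neg-sign : ∀ {ξ} s → HasSignℚ ξ s → HasSignℚ (ℚ.- ξ) (negate s)
neg-sign plus  0<ξ = ℚₚ.neg-antimono-< 0<ξ
neg-sign minus ξ<0 = ℚₚ.neg-antimono-< ξ<0

*-sign : ∀ {ξ η} s t → HasSignℚ ξ s → HasSignℚ η t → HasSignℚ (ξ ℚ.* η) (s *ˢ t)
*-sign {ξ} {η} plus plus 0<ξ 0<η =
  subst (ℚ._< ξ ℚ.* η) (ℚₚ.*-zeroʳ ξ) (ℚₚ.*-monoʳ-<-pos ξ {{ℚ.positive 0<ξ}} 0<η)
*-sign {ξ} {η} plus minus 0<ξ η<0 =
  subst (ξ ℚ.* η ℚ.<_) (ℚₚ.*-zeroʳ ξ) (ℚₚ.*-monoʳ-<-pos ξ {{ℚ.positive 0<ξ}} η<0)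
*-sign {ξ} {η} minus plus ξ<0 0<η =
  subst (ξ ℚ.* η ℚ.<_) (ℚₚ.*-zeroˡ η) (ℚₚ.*-monoˡ-<-pos η {{ℚ.positive 0<η}} ξ<0)
*-sign {ξ} {η} minus minus ξ<0 η<0 =
  subst (ℚ._< ξ ℚ.* η) (ℚₚ.*-zeroˡ η) (ℚₚ.*-monoˡ-<-neg η {{ℚ.negative η<0}} ξ<0)

∣∣-pos : ∀ {ξ} s → HasSignℚ ξ s → 0ℚ ℚ.< ℚ.∣ ξ ∣
∣∣-pos {ξ} plus  0<ξ = subst (0ℚ ℚ.<_) (sym (ℚₚ.0≤p⇒∣p∣≡p (ℚₚ.<⇒≤ 0<ξ))) 0<ξ
∣∣-pos {ξ} minus ξ<0 =
  subst (0ℚ ℚ.<_) (trans (sym (ℚₚ.0≤p⇒∣p∣≡p (ℚₚ.<⇒≤ 0<-ξ))) (ℚₚ.∣-p∣≡∣p∣ ξ)) 0<-ξ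
  where
  0<-ξ : 0ℚ ℚ.< ℚ.- ξ
  0<-ξ = neg-sign minus ξ<0

MagnitudeIn : ℚ → ℚ → ℚ → Set
MagnitudeIn m M ξ = m ℚ.≤ ℚ.∣ ξ ∣ × ℚ.∣ ξ ∣ ℚ.≤ M

Within : Sgn × Sgn → ℚ → ℚ → ℚ² → Set
Within q m M (ξ , η) = InQuadrantℚ (ξ , η) q × MagnitudeIn m M ξ × MagnitudeIn m M η

magnitude-neg : ∀ {m M ξ} → MagnitudeIn m M ξ → MagnitudeIn m M (ℚ.- ξ)
magnitude-neg {m} {M} {ξ} = subst (λ r → m ℚ.≤ r × r ℚ.≤ M) (sym (ℚₚ.∣-p∣≡∣p∣ ξ))

within-turnʳ : ∀ {m M} q w → Within q m M w → Within (turnᵠ q) m M (turnʳ w)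
within-turnʳ (s , t) (ξ , η) ((sξ , tη) , mξ , mη) = (tη , neg-sign s sξ) , mη , magnitude-neg mξ

within-turnsʳ : ∀ {m M} k q w → Within q m M w →
                Within (iterate turnᵠ q k) m M (iterate turnʳ w k)
within-turnsʳ zero    q w within = within
within-turnsʳ (suc k) q w within = within-turnsʳ k (turnᵠ q) (turnʳ w) (within-turnʳ q w within)

BelowSlope : ℕ → ℤ² → Set
BelowSlope C (a , b) = (a ℤ.< 0ℤ → b ℤ.< 0ℤ) × (0ℤ ℤ.≤ a → b ℤ.≤ + C ℤ.* a)

below-slope : ∀ {m M} C {w} → Within (plus , plus) m M w → M ℚ.≤ ι (+ C) ℚ.* m →
              ∀ u → cross w (ι² u) ℚ.≤ 0ℚ → BelowSlope C u
below-slope {m} {M} C {α , β} ((0<α , 0<β) , (m≤∣α∣ , _) , (_ , ∣β∣≤M)) M≤Cm (a , b) cross≤0 =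
  b<0 , b≤Ca
  where
  open ℚₚ.≤-Reasoning
  instance
    α-pos : ℚ.Positive α
    α-pos = ℚ.positive 0<α
    α-nonNeg : ℚ.NonNegative α
    α-nonNeg = ℚ.nonNegative (ℚₚ.<⇒≤ 0<α)

  0≤ιC : 0ℚ ℚ.≤ ι (+ C)
  0≤ιC = ι-mono-≤ {0ℤ} {+ C} (ℤ.+≤+ ℕ.z≤n)

  β≤Cα : β ℚ.≤ ι (+ C) ℚ.* α
  β≤Cα = begin
    β                   ≡⟨ sym (ℚₚ.0≤p⇒∣p∣≡p (ℚₚ.<⇒≤ 0<β)) ⟩
    ℚ.∣ β ∣             ≤⟨ ∣β∣≤M ⟩
    M                   ≤⟨ M≤Cm ⟩
    ι (+ C) ℚ.* m       ≤⟨ ℚₚ.*-monoˡ-≤-nonNeg (ι (+ C)) {{ℚ.nonNegative 0≤ιC}} m≤∣α∣ ⟩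
    ι (+ C) ℚ.* ℚ.∣ α ∣ ≡⟨ cong (ι (+ C) ℚ.*_) (ℚₚ.0≤p⇒∣p∣≡p (ℚₚ.<⇒≤ 0<α)) ⟩
    ι (+ C) ℚ.* α       ∎

  αb≤βa : α ℚ.* ι b ℚ.≤ β ℚ.* ι a
  αb≤βa = sub-≤0⇒≤ cross≤0

  b<0 : a ℤ.< 0ℤ → b ℤ.< 0ℤ
  b<0 a<0 = ι-cancel-< (ℚₚ.*-cancelˡ-<-nonNeg α (begin-strict
    α ℚ.* ι b   ≤⟨ αb≤βa ⟩
    β ℚ.* ι a   <⟨ ℚₚ.*-monoʳ-<-pos β {{ℚ.positive 0<β}} (ι-mono-< a<0) ⟩
    β ℚ.* 0ℚ    ≡⟨ trans (ℚₚ.*-zeroʳ β) (sym (ℚₚ.*-zeroʳ α)) ⟩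
    α ℚ.* 0ℚ    ∎))

  b≤Ca : 0ℤ ℤ.≤ a → b ℤ.≤ + C ℤ.* a
  b≤Ca 0≤a = ι-cancel-≤ (ℚₚ.*-cancelˡ-≤-pos α (begin
    α ℚ.* ι b                   ≤⟨ αb≤βa ⟩
    β ℚ.* ι a                   ≤⟨ ℚₚ.*-monoʳ-≤-nonNeg (ι a) {{ℚ.nonNegative (ι-mono-≤ 0≤a)}} β≤Cα ⟩
    ι (+ C) ℚ.* α ℚ.* ι a       ≡⟨ rearrange ⟩
    α ℚ.* ι (+ C ℤ.* a)         ∎))
    where
    open ℚSolver.+-*-Solver
    rearrange : ι (+ C) ℚ.* α ℚ.* ι a ≡ α ℚ.* ι (+ C ℤ.* a)
    rearrange rewrite ι-* (+ C) a =
      solve 3 (λ c α a → c :* α :* a := α :* (c :* a)) refl (ι (+ C)) α (ι a)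

below-slope-mirror : ∀ {m M} C {w} → Within (plus , minus) m M w → M ℚ.≤ ι (+ C) ℚ.* m →
                     ∀ a b → cross (ι² (a , b)) w ℚ.≤ 0ℚ → BelowSlope C (a , ℤ.- b)
below-slope-mirror C {α , β} ((0<α , β<0) , mα , mβ) M≤Cm a b cross≤0 =
  below-slope C ((0<α , neg-sign minus β<0) , mα , magnitude-neg mβ) M≤Cm (a , ℤ.- b)
    (subst (ℚ._≤ 0ℚ) (sym (cross-mirror α β a b)) cross≤0)

InCone : ℕ → ℤ² → Set
InCone C (a , b) =
  (a ≡ 0ℤ × b ≡ 0ℤ) ⊎ ∃ λ k → a ≡ + suc k × ℤ.- + (suc k ℕ.* C) ℤ.≤ b × b ℤ.≤ + (suc k ℕ.* C)

private
  0≤-neg : ∀ {b} → ℤ.- b ℤ.≤ 0ℤ → 0ℤ ℤ.≤ b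
  0≤-neg {b} -b≤0 = subst (0ℤ ℤ.≤_) (ℤₚ.neg-involutive b) (ℤₚ.neg-mono-≤ -b≤0)

  scale-≤ : ∀ {C D} n → C ℕ.≤ D → + C ℤ.* + n ℤ.≤ + (n ℕ.* D)
  scale-≤ {C} {D} n C≤D = subst (ℤ._≤ + (n ℕ.* D)) (ℤₚ.pos-* C n)
    (ℤ.+≤+ (subst (ℕ._≤ n ℕ.* D) (ℕₚ.*-comm n C) (ℕₚ.*-monoʳ-≤ n C≤D)))

in-cone : ∀ C₁ C₂ a b → BelowSlope C₁ (a , b) → BelowSlope C₂ (a , ℤ.- b) →
          InCone (C₁ ℕ.+ C₂) (a , b)
in-cone C₁ C₂ -[1+ n ] b (b<0 , _) (-b<0 , _) =
  ⊥-elim (ℤₚ.<-asym (b<0 ℤ.-<+) (subst (0ℤ ℤ.<_) (ℤₚ.neg-involutive b) (ℤₚ.neg-mono-< (-b<0 ℤ.-<+))))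
in-cone C₁ C₂ (+ zero) b (_ , b≤0) (_ , -b≤0) =
  inj₁ (refl , ℤₚ.≤-antisym (subst (b ℤ.≤_) (ℤₚ.*-zeroʳ (+ C₁)) (b≤0 (ℤ.+≤+ ℕ.z≤n)))
                            (0≤-neg (subst (ℤ.- b ℤ.≤_) (ℤₚ.*-zeroʳ (+ C₂)) (-b≤0 (ℤ.+≤+ ℕ.z≤n)))))
in-cone C₁ C₂ (+ suc k) b (_ , b≤C₁a) (_ , -b≤C₂a) = inj₂ (k , refl , lower , upper)
  where
  upper : b ℤ.≤ + (suc k ℕ.* (C₁ ℕ.+ C₂))
  upper = ℤₚ.≤-trans (b≤C₁a (ℤ.+≤+ ℕ.z≤n)) (scale-≤ (suc k) (ℕₚ.m≤m+n C₁ C₂))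
  lower : ℤ.- + (suc k ℕ.* (C₁ ℕ.+ C₂)) ℤ.≤ b
  lower = subst (ℤ.- + (suc k ℕ.* (C₁ ℕ.+ C₂)) ℤ.≤_) (ℤₚ.neg-involutive b)
            (ℤₚ.neg-mono-≤ (ℤₚ.≤-trans (-b≤C₂a (ℤ.+≤+ ℕ.z≤n)) (scale-≤ (suc k) (ℕₚ.m≤n+m C₂ C₁))))

private
  ≤-ι-∣numerator∣ : ∀ w → w ℚ.≤ ι (+ ℤ.∣ ℚ.↥ w ∣)
  ≤-ι-∣numerator∣ (mkℚ n d _) rewrite ι-mkℚ (+ ℤ.∣ n ∣) = ℚ.*≤* (bound n)
    where
    bound : ∀ n → n ℤ.* + 1 ℤ.≤ + ℤ.∣ n ∣ ℤ.* + suc d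
    bound (+ m)    = subst₂ ℤ._≤_ (sym (ℤₚ.*-identityʳ (+ m))) (ℤₚ.pos-* m (suc d))
                       (ℤ.+≤+ (subst (ℕ._≤ m ℕ.* suc d) (ℕₚ.*-identityʳ m)
                                     (ℕₚ.*-monoʳ-≤ m (ℕ.s≤s ℕ.z≤n))))
    bound -[1+ m ] = ℤ.-≤+

archimedean : ∀ p q → 0ℚ ℚ.< p → ∃ λ C → q ℚ.≤ ι (+ C) ℚ.* p
archimedean p q 0<p = ℤ.∣ ℚ.↥ w ∣ ,
  subst (ℚ._≤ ι (+ ℤ.∣ ℚ.↥ w ∣) ℚ.* p) w*p≡q
    (ℚₚ.*-monoʳ-≤-nonNeg p {{ℚ.nonNegative (ℚₚ.<⇒≤ 0<p)}} (≤-ι-∣numerator∣ w))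
  where
  instance
    p≢0 : ℚ.NonZero p
    p≢0 = ℚ.>-nonZero 0<p
  w : ℚ
  w = q ℚ.* ℚ.1/ p
  w*p≡q : w ℚ.* p ≡ q
  w*p≡q = trans (ℚₚ.*-assoc q (ℚ.1/ p) p) (trans (cong (q ℚ.*_) (ℚₚ.*-inverseˡ p)) (ℚₚ.*-identityʳ q))

Corner : Interval → ℚ → Set
Corner I ξ = ξ ≡ lo I ⊎ ξ ≡ hi I

CornerPoint : IVec → ℚ² → Set
CornerPoint (X , Y) (ξ , η) = Corner X ξ × Corner Y η

private
  selective₄ : ∀ {_∙_ : ℚ → ℚ → ℚ} → Selective _≡_ _∙_ → ∀ w x y z →
               let r = (w ∙ x) ∙ (y ∙ z) in r ≡ w ⊎ r ≡ x ⊎ r ≡ y ⊎ r ≡ z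
  selective₄ {_∙_} sel w x y z with sel (w ∙ x) (y ∙ z) | sel w x | sel y z
  ... | inj₁ r≡wx | inj₁ wx≡w | _         = inj₁ (trans r≡wx wx≡w)
  ... | inj₁ r≡wx | inj₂ wx≡x | _         = inj₂ (inj₁ (trans r≡wx wx≡x))
  ... | inj₂ r≡yz | _         | inj₁ yz≡y = inj₂ (inj₂ (inj₁ (trans r≡yz yz≡y)))
  ... | inj₂ r≡yz | _         | inj₂ yz≡z = inj₂ (inj₂ (inj₂ (trans r≡yz yz≡z)))

  product-of-corners : ∀ I J {r} →
    r ≡ lo I ℚ.* lo J ⊎ r ≡ lo I ℚ.* hi J ⊎ r ≡ hi I ℚ.* lo J ⊎ r ≡ hi I ℚ.* hi J →
    ∃₂ λ ξ η → Corner I ξ × Corner J η × r ≡ ξ ℚ.* η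
  product-of-corners I J (inj₁ r≡)               = _ , _ , inj₁ refl , inj₁ refl , r≡
  product-of-corners I J (inj₂ (inj₁ r≡))        = _ , _ , inj₁ refl , inj₂ refl , r≡
  product-of-corners I J (inj₂ (inj₂ (inj₁ r≡))) = _ , _ , inj₂ refl , inj₁ refl , r≡
  product-of-corners I J (inj₂ (inj₂ (inj₂ r≡))) = _ , _ , inj₂ refl , inj₂ refl , r≡

lo-*ᴵ-corners : ∀ I J → ∃₂ λ ξ η → Corner I ξ × Corner J η × lo (I *ᴵ J) ≡ ξ ℚ.* η
lo-*ᴵ-corners I J = product-of-corners I J (selective₄ ℚₚ.⊓-sel _ _ _ _)

hi-*ᴵ-corners : ∀ I J → ∃₂ λ ξ η → Corner I ξ × Corner J η × hi (I *ᴵ J) ≡ ξ ℚ.* η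
hi-*ᴵ-corners I J = product-of-corners I J (selective₄ ℚₚ.⊔-sel _ _ _ _)

lo-*ᴵ-≤-corners : ∀ I J {ξ η} → Corner I ξ → Corner J η → lo (I *ᴵ J) ℚ.≤ ξ ℚ.* η
lo-*ᴵ-≤-corners [ a , b ] [ c , d ] = go
  where
  ac ad bc bd : ℚ
  ac = a ℚ.* c
  ad = a ℚ.* d
  bc = b ℚ.* c
  bd = b ℚ.* d
  go : ∀ {ξ η} → Corner [ a , b ] ξ → Corner [ c , d ] η → lo ([ a , b ] *ᴵ [ c , d ]) ℚ.≤ ξ ℚ.* η
  go (inj₁ refl) (inj₁ refl) = ℚₚ.≤-trans (ℚₚ.p⊓q≤p (ac ℚ.⊓ ad) (bc ℚ.⊓ bd)) (ℚₚ.p⊓q≤p ac ad)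
  go (inj₁ refl) (inj₂ refl) = ℚₚ.≤-trans (ℚₚ.p⊓q≤p (ac ℚ.⊓ ad) (bc ℚ.⊓ bd)) (ℚₚ.p⊓q≤q ac ad)
  go (inj₂ refl) (inj₁ refl) = ℚₚ.≤-trans (ℚₚ.p⊓q≤q (ac ℚ.⊓ ad) (bc ℚ.⊓ bd)) (ℚₚ.p⊓q≤p bc bd)
  go (inj₂ refl) (inj₂ refl) = ℚₚ.≤-trans (ℚₚ.p⊓q≤q (ac ℚ.⊓ ad) (bc ℚ.⊓ bd)) (ℚₚ.p⊓q≤q bc bd)

corners-≤-hi-*ᴵ : ∀ I J {ξ η} → Corner I ξ → Corner J η → ξ ℚ.* η ℚ.≤ hi (I *ᴵ J)
corners-≤-hi-*ᴵ [ a , b ] [ c , d ] = go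
  where
  ac ad bc bd : ℚ
  ac = a ℚ.* c
  ad = a ℚ.* d
  bc = b ℚ.* c
  bd = b ℚ.* d
  go : ∀ {ξ η} → Corner [ a , b ] ξ → Corner [ c , d ] η → ξ ℚ.* η ℚ.≤ hi ([ a , b ] *ᴵ [ c , d ])
  go (inj₁ refl) (inj₁ refl) = ℚₚ.≤-trans (ℚₚ.p≤p⊔q ac ad) (ℚₚ.p≤p⊔q (ac ℚ.⊔ ad) (bc ℚ.⊔ bd))
  go (inj₁ refl) (inj₂ refl) = ℚₚ.≤-trans (ℚₚ.p≤q⊔p ac ad) (ℚₚ.p≤p⊔q (ac ℚ.⊔ ad) (bc ℚ.⊔ bd))
  go (inj₂ refl) (inj₁ refl) = ℚₚ.≤-trans (ℚₚ.p≤p⊔q bc bd) (ℚₚ.p≤q⊔p (ac ℚ.⊔ ad) (bc ℚ.⊔ bd))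
  go (inj₂ refl) (inj₂ refl) = ℚₚ.≤-trans (ℚₚ.p≤q⊔p bc bd) (ℚₚ.p≤q⊔p (ac ℚ.⊔ ad) (bc ℚ.⊔ bd))

lo-crossᴵ-corners : ∀ E₁ E₂ → ∃₂ λ w₁ w₂ →
                    CornerPoint E₁ w₁ × CornerPoint E₂ w₂ × lo (crossᴵ E₁ E₂) ≡ cross w₁ w₂
lo-crossᴵ-corners (X₁ , Y₁) (X₂ , Y₂)
  with lo-*ᴵ-corners X₁ Y₂ | hi-*ᴵ-corners Y₁ X₂
... | ξ₁ , η₂ , cξ₁ , cη₂ , lo≡ | η₁ , ξ₂ , cη₁ , cξ₂ , hi≡ =
  (ξ₁ , η₁) , (ξ₂ , η₂) , (cξ₁ , cη₁) , (cξ₂ , cη₂) , cong₂ (λ r s → r ℚ.+ ℚ.- s) lo≡ hi≡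

cross-≤-hi-crossᴵ : ∀ E₁ E₂ {w₁ w₂} → CornerPoint E₁ w₁ → CornerPoint E₂ w₂ →
                    cross w₁ w₂ ℚ.≤ hi (crossᴵ E₁ E₂)
cross-≤-hi-crossᴵ (X₁ , Y₁) (X₂ , Y₂) (cξ₁ , cη₁) (cξ₂ , cη₂) =
  ℚₚ.+-mono-≤ (corners-≤-hi-*ᴵ X₁ Y₂ cξ₁ cη₂) (ℚₚ.neg-antimono-≤ (lo-*ᴵ-≤-corners Y₁ X₂ cη₁ cξ₂))

point-corner : ∀ v {w} → CornerPoint (pointVec v) w → w ≡ ι² v
point-corner (a , b) (inj₁ refl , inj₁ refl) = refl
point-corner (a , b) (inj₁ refl , inj₂ refl) = refl
point-corner (a , b) (inj₂ refl , inj₁ refl) = refl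
point-corner (a , b) (inj₂ refl , inj₂ refl) = refl

L<U : ∀ x {p q} → L x p → U x q → p ℚ.< q
L<U x {p} {q} Lp Uq with ℚₚ.<-cmp p q
... | tri< p<q _ _ = p<q
... | tri≈ _ p≡q _ = ⊥-elim (disjoint x (Lp , subst (U x) (sym p≡q) Uq))
... | tri> _ _ q<p = ⊥-elim (disjoint x (Lp , U-upward x q<p Uq))

signed-corner : ∀ x s (e : Encl x) → HasSign x s → ∃ λ ξ → Corner (encl {x} e) ξ × HasSignℚ ξ s
signed-corner x plus  ((p , q) , _ , Uq) 0<x = q , inj₂ refl , L<U x 0<x Uq
signed-corner x minus ((p , q) , Lp , _) x<0 = p , inj₁ refl , L<U x Lp x<0

SignedEncl : ℝ → Sgn → Set
SignedEncl x s = Σ (Encl x) λ e → HasSignℚ (lo (encl {x} e)) s × HasSignℚ (hi (encl {x} e)) s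

signed-encl : ∀ x s → HasSign x s → SignedEncl x s
signed-encl x plus 0<x with L-rounded x 0<x | U-inhabited x
... | r , 0<r , Lr | q , Uq = ((r , q) , Lr , Uq) , 0<r , ℚₚ.<-trans 0<r (L<U x Lr Uq)
signed-encl x minus x<0 with U-rounded x x<0 | L-inhabited x
... | r , r<0 , Ur | p , Lp = ((p , r) , Lp , Ur) , ℚₚ.<-trans (L<U x Lp Ur) r<0 , r<0

corner-sign : ∀ I s {ξ} → HasSignℚ (lo I) s → HasSignℚ (hi I) s → Corner I ξ → HasSignℚ ξ s
corner-sign I s lo-sign _ (inj₁ refl) = lo-sign
corner-sign I s _ hi-sign (inj₂ refl) = hi-sign

inner-magnitude outer-magnitude : Interval → ℚ
inner-magnitude I = ℚ.∣ lo I ∣ ℚ.⊓ ℚ.∣ hi I ∣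
outer-magnitude I = ℚ.∣ lo I ∣ ℚ.⊔ ℚ.∣ hi I ∣

corner-magnitude : ∀ I {ξ} → Corner I ξ → MagnitudeIn (inner-magnitude I) (outer-magnitude I) ξ
corner-magnitude I (inj₁ refl) = ℚₚ.p⊓q≤p ℚ.∣ lo I ∣ ℚ.∣ hi I ∣ , ℚₚ.p≤p⊔q ℚ.∣ lo I ∣ ℚ.∣ hi I ∣
corner-magnitude I (inj₂ refl) = ℚₚ.p⊓q≤q ℚ.∣ lo I ∣ ℚ.∣ hi I ∣ , ℚₚ.p≤q⊔p ℚ.∣ lo I ∣ ℚ.∣ hi I ∣

magnitude-widen : ∀ {m m′ M M′ ξ} → m′ ℚ.≤ m → M ℚ.≤ M′ →
                  MagnitudeIn m M ξ → MagnitudeIn m′ M′ ξ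
magnitude-widen m′≤m M≤M′ (m≤∣ξ∣ , ∣ξ∣≤M) = ℚₚ.≤-trans m′≤m m≤∣ξ∣ , ℚₚ.≤-trans ∣ξ∣≤M M≤M′

⊓-pos : ∀ {p q} → 0ℚ ℚ.< p → 0ℚ ℚ.< q → 0ℚ ℚ.< p ℚ.⊓ q
⊓-pos {p} {q} 0<p 0<q with ℚₚ.⊓-sel p q
... | inj₁ p⊓q≡p = subst (0ℚ ℚ.<_) (sym p⊓q≡p) 0<p
... | inj₂ p⊓q≡q = subst (0ℚ ℚ.<_) (sym p⊓q≡q) 0<q

record TightEncl (d : ℝ²) (q : Sgn × Sgn) : Set where
  field
    enclosure     : EnclVec d
    inner outer   : ℚ
    inner-pos     : 0ℚ ℚ.< inner
    corner-within : ∀ {w} → CornerPoint (enclVec {d} enclosure) w → Within q inner outer w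
open TightEncl

tight-encl : ∀ x y s t → InOpenQuadrant (x , y) s t → TightEncl (x , y) (s , t)
tight-encl x y s t (sx , ty) with signed-encl x s sx | signed-encl y t ty
... | ex , lo-s , hi-s | ey , lo-t , hi-t = record
  { enclosure     = ex , ey
  ; inner         = inner-magnitude X ℚ.⊓ inner-magnitude Y
  ; outer         = outer-magnitude X ℚ.⊔ outer-magnitude Y
  ; inner-pos     = ⊓-pos (⊓-pos (∣∣-pos s lo-s) (∣∣-pos s hi-s)) (⊓-pos (∣∣-pos t lo-t) (∣∣-pos t hi-t))
  ; corner-within = λ (cξ , cη) →
      (corner-sign X s lo-s hi-s cξ , corner-sign Y t lo-t hi-t cη) ,
      magnitude-widen (ℚₚ.p⊓q≤p (inner-magnitude X) (inner-magnitude Y))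
                      (ℚₚ.p≤p⊔q (outer-magnitude X) (outer-magnitude Y)) (corner-magnitude X cξ) ,
      magnitude-widen (ℚₚ.p⊓q≤q (inner-magnitude X) (inner-magnitude Y))
                      (ℚₚ.p≤q⊔p (outer-magnitude X) (outer-magnitude Y)) (corner-magnitude Y cη)
  }
  where
  X Y : Interval
  X = encl {x} ex
  Y = encl {y} ey

-- Orientation of the two half-lines

cross-pos : ∀ {ξ₁ η₁ ξ₂ η₂} s₁ t₁ s₂ t₂ → s₁ *ˢ t₂ ≡ plus → t₁ *ˢ s₂ ≡ minus →
            InQuadrantℚ (ξ₁ , η₁) (s₁ , t₁) → InQuadrantℚ (ξ₂ , η₂) (s₂ , t₂) →
            0ℚ ℚ.< cross (ξ₁ , η₁) (ξ₂ , η₂)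
cross-pos s₁ t₁ s₂ t₂ s₁t₂≡+ t₁s₂≡- (sξ₁ , tη₁) (sξ₂ , tη₂) =
  ℚₚ.+-mono-< (subst (HasSignℚ _) s₁t₂≡+ (*-sign s₁ t₂ sξ₁ tη₂))
              (neg-sign minus (subst (HasSignℚ _) t₁s₂≡- (*-sign t₁ s₂ tη₁ sξ₂)))

tight-cross-pos : ∀ {d₁ d₂ s₁ t₁ s₂ t₂} → s₁ *ˢ t₂ ≡ plus → t₁ *ˢ s₂ ≡ minus →
  (T₁ : TightEncl d₁ (s₁ , t₁)) (T₂ : TightEncl d₂ (s₂ , t₂)) →
  0ℚ ℚ.< lo (crossᴵ (enclVec {d₁} (enclosure T₁)) (enclVec {d₂} (enclosure T₂)))
tight-cross-pos {d₁} {d₂} {s₁} {t₁} {s₂} {t₂} +≡ -≡ T₁ T₂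
  with lo-crossᴵ-corners (enclVec {d₁} (enclosure T₁)) (enclVec {d₂} (enclosure T₂))
... | (ξ₁ , η₁) , (ξ₂ , η₂) , c₁ , c₂ , lo≡ =
  subst (0ℚ ℚ.<_) (sym lo≡)
    (cross-pos s₁ t₁ s₂ t₂ +≡ -≡ (proj₁ (corner-within T₁ c₁)) (proj₁ (corner-within T₂ c₂)))

counterclockwise-not-small : ∀ x₁ y₁ x₂ y₂ s₁ t₁ s₂ t₂ → s₁ *ˢ t₂ ≡ plus → t₁ *ˢ s₂ ≡ minus →
  InOpenQuadrant (x₁ , y₁) s₁ t₁ → InOpenQuadrant (x₂ , y₂) s₂ t₂ → ¬ Small (x₁ , y₁) (x₂ , y₂)
counterclockwise-not-small x₁ y₁ x₂ y₂ s₁ t₁ s₂ t₂ +≡ -≡ (sx₁ , ty₁) (sx₂ , ty₂)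
                           (inj₁ (e₁ , e₂ , hi<0))
  with signed-corner x₁ s₁ (proj₁ e₁) sx₁ | signed-corner y₁ t₁ (proj₂ e₁) ty₁
     | signed-corner x₂ s₂ (proj₁ e₂) sx₂ | signed-corner y₂ t₂ (proj₂ e₂) ty₂
... | ξ₁ , cξ₁ , sξ₁ | η₁ , cη₁ , tη₁ | ξ₂ , cξ₂ , sξ₂ | η₂ , cη₂ , tη₂ =
  ℚₚ.<-asym (cross-pos s₁ t₁ s₂ t₂ +≡ -≡ (sξ₁ , tη₁) (sξ₂ , tη₂))
    (ℚₚ.≤-<-trans (cross-≤-hi-crossᴵ (enclVec {x₁ , y₁} e₁) (enclVec {x₂ , y₂} e₂)
                                      (cξ₁ , cη₁) (cξ₂ , cη₂))
                  hi<0)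
counterclockwise-not-small x₁ y₁ x₂ y₂ s₁ t₁ s₂ t₂ +≡ -≡ q₁ q₂ (inj₂ (lo≤0 , _)) =
  ℚₚ.<-irrefl refl (ℚₚ.<-≤-trans (tight-cross-pos +≡ -≡ T₁ T₂) (lo≤0 (enclosure T₁) (enclosure T₂)))
  where
  T₁ : TightEncl (x₁ , y₁) (s₁ , t₁)
  T₁ = tight-encl x₁ y₁ s₁ t₁ q₁
  T₂ : TightEncl (x₂ , y₂) (s₂ , t₂)
  T₂ = tight-encl x₂ y₂ s₂ t₂ q₂

-- The wedge in frame coordinates

_+²_ : ℤ² → ℤ² → ℤ²
(a , b) +² (c , d) = a ℤ.+ c , b ℤ.+ d

+²-minus : ∀ O z → (O +² z) -² O ≡ z
+²-minus (o₁ , o₂) (a , b) = cong₂ _,_ (cancel o₁ a) (cancel o₂ b)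
  where
  open ℤSolver.+-*-Solver
  cancel : ∀ o a → o ℤ.+ a ℤ.- o ≡ a
  cancel = solve 2 (λ o a → o :+ a :- o := a) refl

module _ (k : ℕ) {d q} (T : TightEncl d q) (C : ℕ) (outer≤Cinner : outer T ℚ.≤ ι (+ C) ℚ.* inner T) where

  below-slope-right : iterate turnᵠ q k ≡ (plus , plus) → ∀ u →
    lo (crossᴵ (enclVec {d} (enclosure T)) (pointVec (fold u turnˡ k))) ℚ.≤ 0ℚ → BelowSlope C u
  below-slope-right q≡ u lo≤0
    with lo-crossᴵ-corners (enclVec {d} (enclosure T)) (pointVec (fold u turnˡ k))
  ... | w , v , cw , cv , lo≡ rewrite point-corner (fold u turnˡ k) cv =
    below-slope C (subst (λ q → Within q (inner T) (outer T) (iterate turnʳ w k)) q≡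
                         (within-turnsʳ k q w (corner-within T cw)))
      outer≤Cinner u (subst (ℚ._≤ 0ℚ) (trans lo≡ (cross-turnsˡ-right k w u)) lo≤0)

  below-slope-left : iterate turnᵠ q k ≡ (plus , minus) → ∀ a b →
    lo (crossᴵ (pointVec (fold (a , b) turnˡ k)) (enclVec {d} (enclosure T))) ℚ.≤ 0ℚ →
    BelowSlope C (a , ℤ.- b)
  below-slope-left q≡ a b lo≤0
    with lo-crossᴵ-corners (pointVec (fold (a , b) turnˡ k)) (enclVec {d} (enclosure T))
  ... | v , w , cv , cw , lo≡ rewrite point-corner (fold (a , b) turnˡ k) cv =
    below-slope-mirror C (subst (λ q → Within q (inner T) (outer T) (iterate turnʳ w k)) q≡
                                (within-turnsʳ k q w (corner-within T cw)))
      outer≤Cinner a b (subst (ℚ._≤ 0ℚ) (trans lo≡ (cross-turnsˡ-left k (a , b) w)) lo≤0)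

wedge-in-cone : ∀ k O {d₁ d₂ q₁ q₂} → TightEncl d₁ q₁ → TightEncl d₂ q₂ →
  iterate turnᵠ q₁ k ≡ (plus , plus) → iterate turnᵠ q₂ k ≡ (plus , minus) →
  ∃ λ C → ∀ u → InSmallWedge O d₁ d₂ (O +² fold u turnˡ k) → InCone C u
wedge-in-cone k O {d₁} {d₂} T₁ T₂ q₁≡ q₂≡
  with archimedean (inner T₁) (outer T₁) (inner-pos T₁)
     | archimedean (inner T₂) (outer T₂) (inner-pos T₂)
... | C₁ , outer≤C₁inner | C₂ , outer≤C₂inner = C₁ ℕ.+ C₂ , cone
  where
  cone : ∀ u → InSmallWedge O d₁ d₂ (O +² fold u turnˡ k) → InCone (C₁ ℕ.+ C₂) u
  cone (a , b) (right , left , _) = in-cone C₁ C₂ a b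
    (below-slope-right k T₁ C₁ outer≤C₁inner q₁≡ (a , b)
      (subst (λ v → lo (crossᴵ (enclVec {d₁} (enclosure T₁)) (pointVec v)) ℚ.≤ 0ℚ) (+²-minus O _)
        (right (enclosure T₁) (enclosure T₂))))
    (below-slope-left k T₂ C₂ outer≤C₂inner q₂≡ a b
      (subst (λ v → lo (crossᴵ (pointVec v) (enclVec {d₂} (enclosure T₂))) ℚ.≤ 0ℚ) (+²-minus O _)
        (left (enclosure T₁) (enclosure T₂))))

record Frame (O : ℤ²) : Set where
  field
    embed           : ℤ² → ℤ²
    turn            : Port → Port
    move-turn       : ∀ p u → move (turn p) (embed u) ≡ embed (move p u)
    embed-injective : ∀ {u w} → embed u ≡ embed w → u ≡ w
    embed-origin    : embed (0ℤ , 0ℤ) ≡ O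

turnᴾ : Port → Port
turnᴾ E = N
turnᴾ N = W
turnᴾ W = S
turnᴾ S = E

module _ where
  open ℤSolver.+-*-Solver

  move-turnˡ : ∀ p u → move (turnᴾ p) (turnˡ u) ≡ turnˡ (move p u)
  move-turnˡ E (a , b) = refl
  move-turnˡ N (a , b) = cong (_, a) (solve 1 (λ b → :- b :- con (+ 1) := :- (b :+ con (+ 1))) refl b)
  move-turnˡ W (a , b) = refl
  move-turnˡ S (a , b) = cong (_, a) (solve 1 (λ b → :- b :+ con (+ 1) := :- (b :- con (+ 1))) refl b)

  move-+² : ∀ p O u → move p (O +² u) ≡ O +² move p u
  move-+² N (o₁ , o₂) (a , b) = cong (o₁ ℤ.+ a ,_) (ℤₚ.+-assoc o₂ b (+ 1))
  move-+² E (o₁ , o₂) (a , b) = cong (_, o₂ ℤ.+ b) (ℤₚ.+-assoc o₁ a (+ 1))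
  move-+² S (o₁ , o₂) (a , b) = cong (o₁ ℤ.+ a ,_) (ℤₚ.+-assoc o₂ b (ℤ.- + 1))
  move-+² W (o₁ , o₂) (a , b) = cong (_, o₂ ℤ.+ b) (ℤₚ.+-assoc o₁ a (ℤ.- + 1))

  +²-identityʳ : ∀ O → O +² (0ℤ , 0ℤ) ≡ O
  +²-identityʳ (o₁ , o₂) = cong₂ _,_ (ℤₚ.+-identityʳ o₁) (ℤₚ.+-identityʳ o₂)

  turnˡ-surjective : ∀ v → ∃ λ u → turnˡ u ≡ v
  turnˡ-surjective (a , b) = (b , ℤ.- a) , cong (_, b) (ℤₚ.neg-involutive a)

move-turnsˡ : ∀ k p u → move (fold p turnᴾ k) (fold u turnˡ k) ≡ fold (move p u) turnˡ k
move-turnsˡ zero    p u = refl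
move-turnsˡ (suc k) p u =
  trans (move-turnˡ (fold p turnᴾ k) (fold u turnˡ k)) (cong turnˡ (move-turnsˡ k p u))

turnˡ-injective : ∀ {u w} → turnˡ u ≡ turnˡ w → u ≡ w
turnˡ-injective eq = cong₂ _,_ (,-injectiveʳ eq) (ℤₚ.neg-injective (,-injectiveˡ eq))

turnsˡ-injective : ∀ k {u w} → fold u turnˡ k ≡ fold w turnˡ k → u ≡ w
turnsˡ-injective zero    eq = eq
turnsˡ-injective (suc k) eq = turnsˡ-injective k (turnˡ-injective eq)

turnsˡ-origin : ∀ k → fold (0ℤ , 0ℤ) turnˡ k ≡ (0ℤ , 0ℤ)
turnsˡ-origin zero    = refl
turnsˡ-origin (suc k) = cong turnˡ (turnsˡ-origin k)

turnsˡ-surjective : ∀ k v → ∃ λ u → fold u turnˡ k ≡ v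
turnsˡ-surjective zero    v = v , refl
turnsˡ-surjective (suc k) v with turnˡ-surjective v
... | w , turn-w≡v with turnsˡ-surjective k w
...   | u , turns-u≡w = u , trans (cong turnˡ turns-u≡w) turn-w≡v

rotated : ∀ O k → Frame O
rotated O k = record
  { embed           = λ u → O +² fold u turnˡ k
  ; turn            = λ p → fold p turnᴾ k
  ; move-turn       = λ p u → trans (move-+² (fold p turnᴾ k) O (fold u turnˡ k))
                                    (cong (O +²_) (move-turnsˡ k p u))
  ; embed-injective = λ {u} {w} eq → turnsˡ-injective k
                        (trans (sym (+²-minus O _)) (trans (cong (_-² O) eq) (+²-minus O _)))
  ; embed-origin    = trans (cong (O +²_) (turnsˡ-origin k)) (+²-identityʳ O)
  }

rotated-surjective : ∀ O k x → ∃ λ u → O +² fold u turnˡ k ≡ x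
rotated-surjective O k x with turnsˡ-surjective k (x -² O)
... | u , turns-u≡ = u , trans (cong (O +²_) turns-u≡) (+²-cancel O x)
  where
  open ℤSolver.+-*-Solver
  +²-cancel : ∀ O x → O +² (x -² O) ≡ x
  +²-cancel (o₁ , o₂) (a , b) = cong₂ _,_ (solve 2 (λ o a → o :+ (a :- o) := a) refl o₁ a)
                                          (solve 2 (λ o b → o :+ (b :- o) := b) refl o₂ b)

-- The automaton and its run

data State (C : ℕ) : Set where
  dropOrigin dropBelow seekN seekS : State C
  countN countS            : Fin (suc C) → State C

instruction : ∀ {C} → State C → Bool → Port × Action × State C
instruction     dropOrigin       _     = S , drop , dropBelow
instruction     dropBelow           _     = N , drop , seekN
instruction {C} seekN            true  = E , pick , countN (fromℕ C)
instruction     seekN            false = N , none , seekN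
instruction     (countN zero)    _     = W , drop , seekS
instruction     (countN (suc i)) _     = N , none , countN (inject₁ i)
instruction {C} seekS            true  = E , pick , countS (fromℕ C)
instruction     seekS            false = S , none , seekS
instruction     (countS zero)    _     = N , drop , seekN
instruction     (countS (suc i)) _     = S , none , countS (inject₁ i)

stateCount : ℕ → ℕ
stateCount C = 4 ℕ.+ (suc C ℕ.+ suc C)

encode : ∀ {C} → State C → Fin (stateCount C)
encode     dropOrigin = zero
encode     dropBelow     = suc zero
encode     seekN      = suc (suc zero)
encode     seekS      = suc (suc (suc zero))
encode {C} (countN i) = suc (suc (suc (suc (i ↑ˡ suc C))))
encode {C} (countS i) = suc (suc (suc (suc (suc C ↑ʳ i))))

decode : ∀ {C} → Fin (stateCount C) → State C
decode zero                       = dropOrigin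
decode (suc zero)                 = dropBelow
decode (suc (suc zero))           = seekN
decode (suc (suc (suc zero)))     = seekS
decode {C} (suc (suc (suc (suc i)))) with splitAt (suc C) i
... | inj₁ i₁ = countN i₁
... | inj₂ i₂ = countS i₂

decode-encode : ∀ {C} (s : State C) → decode (encode s) ≡ s
decode-encode     dropOrigin = refl
decode-encode     dropBelow     = refl
decode-encode     seekN      = refl
decode-encode     seekS      = refl
decode-encode {C} (countN i) rewrite Finₚ.splitAt-↑ˡ (suc C) i (suc C) = refl
decode-encode {C} (countS i) rewrite Finₚ.splitAt-↑ʳ (suc C) (suc C) i = refl

explorer : ∀ {O} → Frame O → ℕ → Automaton 2
explorer F C = record
  { nStates = stateCount C
  ; initial = encode dropOrigin
  ; δ       = λ q b _ → framed (instruction (decode q) b)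
  }
  where
  framed : Port × Action × State C → Port × Action × Fin (stateCount C)
  framed (p , a , s) = Frame.turn F p , a , encode s

module Exploration {O : ℤ²} (F : Frame O) (C : ℕ) where
  open Frame F
  open Automaton (explorer F C) using (δ)
  open Run (explorer F C)

  set-≗ : ∀ {f g} x b → f ≗ g → set f x b ≗ set g x b
  set-≗ x b f≗g z with ≡-dec ℤ._≟_ ℤ._≟_ x z
  ... | yes _ = refl
  ... | no  _ = f≗g z

  set-here : ∀ f x b → set f x b x ≡ b
  set-here f x b with ≡-dec ℤ._≟_ ℤ._≟_ x x
  ... | yes _   = refl
  ... | no  x≢x = ⊥-elim (x≢x refl)

  set-elsewhere : ∀ f {x z} b → x ≢ z → set f x b z ≡ f z
  set-elsewhere f {x} {z} b x≢z with ≡-dec ℤ._≟_ ℤ._≟_ x z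
  ... | yes x≡z = ⊥-elim (x≢z x≡z)
  ... | no  _   = refl

  -- Case splits below go through decide, so that `with` does not also abstract the test inside set.
  private
    decide : ∀ x z → x ≡ z ⊎ x ≢ z
    decide x z with ≡-dec ℤ._≟_ ℤ._≟_ x z
    ... | yes x≡z = inj₁ x≡z
    ... | no  x≢z = inj₂ x≢z

  set-undo : ∀ f x b → f x ≡ false → set (set f x b) x false ≗ f
  set-undo f x b fx≡false z with decide x z
  ... | inj₁ refl = trans (set-here (set f z b) z false) (sym fx≡false)
  ... | inj₂ x≢z  = trans (set-elsewhere (set f x b) false x≢z) (set-elsewhere f b x≢z)

  set-comm : ∀ f {x y} b b′ → x ≢ y → set (set f y b′) x b ≗ set (set f x b) y b′
  set-comm f {x} {y} b b′ x≢y z with decide x z | decide y z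
  ... | inj₁ refl | inj₁ refl = ⊥-elim (x≢y refl)
  ... | inj₁ refl | inj₂ y≢z  =
    trans (set-here (set f y b′) z b) (sym (trans (set-elsewhere (set f z b) b′ y≢z) (set-here f z b)))
  ... | inj₂ x≢z  | inj₁ refl =
    trans (set-elsewhere (set f z b′) b x≢z) (trans (set-here f z b′) (sym (set-here (set f x b) z b′)))
  ... | inj₂ x≢z  | inj₂ y≢z  =
    trans (set-elsewhere (set f y b′) b x≢z)
      (trans (set-elsewhere f b′ y≢z)
        (sym (trans (set-elsewhere (set f x b) b′ y≢z) (set-elsewhere f b x≢z))))

  marked : List ℤ² → ℤ² → Bool
  marked []       = λ _ → false
  marked (x ∷ xs) = set (marked xs) x true

  marked-∉ : ∀ {z} xs → All (_≢ z) xs → marked xs z ≡ false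
  marked-∉ []       []            = refl
  marked-∉ (x ∷ xs) (x≢z ∷ xs≢z) = trans (set-elsewhere (marked xs) true x≢z) (marked-∉ xs xs≢z)

  record At (c : Config) (s : State C) (u : ℤ²) (ps : List ℤ²) (n : ℕ) : Set where
    constructor at
    field
      state≡   : Config.state c ≡ encode s
      pos≡     : Config.pos c ≡ embed u
      pebbles≗ : Config.pebbles c ≗ marked ps
      carried≡ : Config.carried c ≡ n
  open At

  at-swap : ∀ {c s u x y ps n} → x ≢ y → At c s u (x ∷ y ∷ ps) n → At c s u (y ∷ x ∷ ps) n
  at-swap {x = x} {y} {ps} x≢y (at s≡ u≡ pb n≡) =
    at s≡ u≡ (λ z → trans (pb z) (set-comm (marked ps) true true x≢y z)) n≡

  at-moved : ∀ {c s u u′ ps n} → u ≡ u′ → At c s u ps n → At c s u′ ps n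
  at-moved refl here = here

  δ-encode : ∀ s b k {p a s′} → instruction s b ≡ (p , a , s′) →
             δ (encode s) b k ≡ (turn p , a , encode s′)
  δ-encode s b k instr rewrite decode-encode s | instr = refl

  private
    step-none : ∀ q x peb n {p q′} → δ q (peb x) (clamp 2 n) ≡ (p , none , q′) →
                step (config q x peb n) ≡ config q′ (move p x) peb n
    step-none q x peb n δ≡ rewrite δ≡ = refl

    step-pick : ∀ q x peb n {p q′} → δ q (peb x) (clamp 2 n) ≡ (p , pick , q′) → peb x ≡ true →
                step (config q x peb n) ≡ config q′ (move p x) (set peb x false) (suc n)
    step-pick q x peb n δ≡ has rewrite δ≡ | has = refl

    step-drop : ∀ q x peb n {p q′} → δ q (peb x) (clamp 2 (suc n)) ≡ (p , drop , q′) → peb x ≡ false →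
                step (config q x peb (suc n)) ≡ config q′ (move p x) (set peb x true) n
    step-drop q x peb n δ≡ lacks rewrite δ≡ | lacks = refl

  at-none : ∀ {c s u ps n p s′} → At c s u ps n → instruction s (marked ps (embed u)) ≡ (p , none , s′) →
            At (step c) s′ (move p u) ps n
  at-none {config _ _ peb n} {s} {u} {ps} {p = p} {s′} (at refl refl pb refl) instr =
    subst (λ d → At d s′ (move p u) ps n) (sym (step-none (encode s) (embed u) peb n δ≡))
      (at refl (move-turn p u) pb refl)
    where
    δ≡ : δ (encode s) (peb (embed u)) (clamp 2 n) ≡ (turn p , none , encode s′)
    δ≡ = δ-encode s (peb (embed u)) (clamp 2 n) (trans (cong (instruction s) (pb (embed u))) instr)

  at-pick : ∀ {c s u ps n p s′} → At c s u (embed u ∷ ps) n → marked ps (embed u) ≡ false →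
            instruction s true ≡ (p , pick , s′) → At (step c) s′ (move p u) ps (suc n)
  at-pick {config _ _ peb n} {s} {u} {ps} {p = p} {s′} (at refl refl pb refl) free instr =
    subst (λ d → At d s′ (move p u) ps (suc n)) (sym (step-pick (encode s) (embed u) peb n δ≡ has))
      (at refl (move-turn p u)
          (λ z → trans (set-≗ (embed u) false pb z) (set-undo (marked ps) (embed u) true free z)) refl)
    where
    has : peb (embed u) ≡ true
    has = trans (pb (embed u)) (set-here (marked ps) (embed u) true)
    δ≡ : δ (encode s) (peb (embed u)) (clamp 2 n) ≡ (turn p , pick , encode s′)
    δ≡ = δ-encode s (peb (embed u)) (clamp 2 n) (trans (cong (instruction s) has) instr)

  at-drop : ∀ {c s u ps n p s′} → At c s u ps (suc n) → marked ps (embed u) ≡ false →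
            instruction s false ≡ (p , drop , s′) → At (step c) s′ (move p u) (embed u ∷ ps) n
  at-drop {config _ _ peb _} {s} {u} {ps} {n} {p} {s′} (at refl refl pb refl) free instr =
    subst (λ d → At d s′ (move p u) (embed u ∷ ps) n)
      (sym (step-drop (encode s) (embed u) peb n δ≡ lacks))
      (at refl (move-turn p u) (set-≗ (embed u) true pb) refl)
    where
    lacks : peb (embed u) ≡ false
    lacks = trans (pb (embed u)) free
    δ≡ : δ (encode s) (peb (embed u)) (clamp 2 (suc n)) ≡ (turn p , drop , encode s′)
    δ≡ = δ-encode s (peb (embed u)) (clamp 2 (suc n)) (trans (cong (instruction s) lacks) instr)

  _after_ : Config → ℕ → Config
  c after n = iterate step c n

  after-+ : ∀ c m n → c after (m ℕ.+ n) ≡ (c after m) after n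
  after-+ c zero    n = refl
  after-+ c (suc m) n = after-+ (step c) m n

  record Reaches (c : Config) (P : Config → Set) : Set where
    constructor reaches
    field
      steps   : ℕ
      reached : P (c after steps)

  reaches-trans : ∀ {c P Q} → Reaches c P → (∀ {d} → P d → Reaches d Q) → Reaches c Q
  reaches-trans {c} {Q = Q} (reaches n p) next with next p
  ... | reaches m q = reaches (n ℕ.+ m) (subst Q (sym (after-+ c n m)) q)

  Visited : Config → ℤ² → Set
  Visited c u = Reaches c (λ d → Config.pos d ≡ embed u)

  walk : ∀ {s p} → instruction s false ≡ (p , none , s) → ∀ m {c u ps n} →
         (∀ j → j ℕ.< m → marked ps (embed (iterate (move p) u j)) ≡ false) → At c s u ps n →
         At (c after m) s (iterate (move p) u m) ps n ×
         (∀ j → j ℕ.≤ m → Visited c (iterate (move p) u j))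
  walk keep zero    free here = here , λ { zero ℕ.z≤n → reaches 0 (pos≡ here) }
  walk {s} {p} keep (suc m) {c} {u} free here
    with walk keep m (λ j j<m → free (suc j) (ℕ.s≤s j<m))
              (at-none here (trans (cong (instruction s) (free 0 (ℕ.s≤s ℕ.z≤n))) keep))
  ... | there , visits = there , visited
    where
    visited : ∀ j → j ℕ.≤ suc m → Visited c (iterate (move p) u j)
    visited zero    _           = reaches 0 (pos≡ here)
    visited (suc j) (ℕ.s≤s j≤m) with visits j j≤m
    ... | reaches n reached = reaches (suc n) reached

  count : ∀ {cnt : Fin (suc C) → State C} {p} →
          (∀ i b → instruction (cnt (suc i)) b ≡ (p , none , cnt (inject₁ i))) →
          ∀ m (i : Fin (suc C)) → toℕ i ≡ m → ∀ {c u ps n} → At c (cnt i) u ps n →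
          At (c after m) (cnt zero) (iterate (move p) u m) ps n
  count         step-down zero    zero    _  here = here
  count {cnt} step-down (suc m) (suc i) i≡ here =
    count {cnt} step-down m (inject₁ i) (trans (Finₚ.toℕ-inject₁ i) (ℕₚ.suc-injective i≡))
      (at-none here (step-down i _))

  carry : ∀ {s cnt p q s′ c u ps n t t′} →
          instruction s true ≡ (E , pick , cnt (fromℕ C)) →
          (∀ i b → instruction (cnt (suc i)) b ≡ (p , none , cnt (inject₁ i))) →
          (∀ b → instruction (cnt zero) b ≡ (q , drop , s′)) →
          iterate (move p) (move E u) C ≡ t → move q t ≡ t′ →
          At c s u (embed u ∷ ps) n → marked ps (embed u) ≡ false → marked ps (embed t) ≡ false →
          At (c after suc (C ℕ.+ 1)) s′ t′ (embed t ∷ ps) n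
  carry {cnt = cnt} {s′ = s′} {c} {ps = ps} {n} {t} {t′} picks step-down drops refl refl
        here u-free t-free =
    subst (λ d → At d s′ t′ (embed t ∷ ps) n) (sym (after-+ (step c) C 1))
      (at-drop (count {cnt} step-down C (fromℕ C) (Finₚ.toℕ-fromℕ C) (at-pick here u-free picks))
               t-free (drops false))

  top bottom : ℕ → ℤ²
  top    k = + k , + (k ℕ.* C)
  bottom k = + k , -[1+ k ℕ.* C ]

  Ready : ℕ → Config → Set
  Ready k c = At c seekN (top k) (embed (top k) ∷ embed (bottom k) ∷ []) 0

  private
    embed-≢ : ∀ {u w} → u ≢ w → embed u ≢ embed w
    embed-≢ u≢w eq = u≢w (embed-injective eq)

    ≢-first : ∀ {a b c d : ℤ} → a ≢ c → (a , b) ≢ (c , d)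
    ≢-first a≢c eq = a≢c (,-injectiveˡ eq)

    ≢-second : ∀ {a b c d : ℤ} → b ≢ d → (a , b) ≢ (c , d)
    ≢-second b≢d eq = b≢d (,-injectiveʳ eq)

    next-column : ∀ k {b d} → (+ suc k , b) ≢ (+ k , d)
    next-column k = ≢-first (λ eq → ℕₚ.1+n≢n (ℤₚ.+-injective eq))

    top≢bottom : ∀ k → top k ≢ bottom k
    top≢bottom k = ≢-second λ ()

    move-E : ∀ k b → move E (+ k , b) ≡ (+ suc k , b)
    move-E k b = cong (λ n → + n , b) (ℕₚ.+-comm k 1)

    open ℤSolver.+-*-Solver

    upward : ∀ a b j → iterate (move N) (a , b) j ≡ (a , b ℤ.+ + j)
    upward a b zero    = cong (a ,_) (sym (ℤₚ.+-identityʳ b))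
    upward a b (suc j) = trans (upward a (b ℤ.+ + 1) j)
      (cong (a ,_) (solve 2 (λ b j → b :+ con (+ 1) :+ j := b :+ (con (+ 1) :+ j)) refl b (+ j)))

    downward : ∀ a b j → iterate (move S) (a , b) j ≡ (a , b ℤ.- + j)
    downward a b zero    = cong (a ,_) (sym (ℤₚ.+-identityʳ b))
    downward a b (suc j) = trans (downward a (b ℤ.- + 1) j)
      (cong (a ,_) (solve 2 (λ b j → b :- con (+ 1) :- j := b :- (con (+ 1) :+ j)) refl b (+ j)))

  module Round (k : ℕ) where
    K M : ℕ
    K = k ℕ.* C
    M = suc k ℕ.* C

    T Y B : ℤ²
    T = embed (top (suc k))
    Y = embed (bottom k)
    B = embed (bottom (suc k))

    climb : ∀ {c} → Ready k c → Reaches c (λ d → At d seekS (+ k , + M) (T ∷ Y ∷ []) 0)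
    climb here = reaches (suc (C ℕ.+ 1)) $
      carry {cnt = countN} refl (λ _ _ → refl) (λ _ → refl) reach refl here
        (marked-∉ _ (embed-≢ (≢-sym (top≢bottom k)) ∷ []))
        (marked-∉ _ (embed-≢ (≢-sym (next-column k)) ∷ []))
      where
      reach : iterate (move N) (move E (top k)) C ≡ top (suc k)
      reach = trans (cong (λ v → iterate (move N) v C) (move-E k _))
                (trans (upward _ _ C) (cong (λ n → + suc k , + n) (ℕₚ.+-comm K C)))

    descend : ∀ {c} → At c seekS (+ k , + M) (T ∷ Y ∷ []) 0 →
              Reaches c (λ d → At d seekS (bottom k) (Y ∷ T ∷ []) 0)
    descend here = reaches (M ℕ.+ suc K) $
      at-swap (embed-≢ (next-column k)) (at-moved arrive (proj₁ (walk refl (M ℕ.+ suc K) free here)))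
      where
      arrive : iterate (move S) (+ k , + M) (M ℕ.+ suc K) ≡ bottom k
      arrive = trans (downward _ _ (M ℕ.+ suc K))
        (cong (+ k ,_) (solve 2 (λ m s → m :- (m :+ s) := :- s) refl (+ M) (+ suc K)))
      above-bottom : ∀ j → j ℕ.< M ℕ.+ suc K → -[1+ K ] ≢ + M ℤ.- + j
      above-bottom j j<m eq = ℕₚ.<-irrefl (ℤₚ.+-injective j≡) j<m
        where
        j≡ : + j ≡ + M ℤ.- -[1+ K ]
        j≡ = trans (solve 2 (λ m j → j := m :- (m :- j)) refl (+ M) (+ j)) (cong (ℤ._-_ (+ M)) (sym eq))
      free : ∀ j → j ℕ.< M ℕ.+ suc K →
             marked (T ∷ Y ∷ []) (embed (iterate (move S) (+ k , + M) j)) ≡ false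
      free j j<m rewrite downward (+ k) (+ M) j =
        marked-∉ _ (embed-≢ (next-column k) ∷ embed-≢ (≢-second (above-bottom j j<m)) ∷ [])

    traverse : ∀ {c} → At c seekS (bottom k) (Y ∷ T ∷ []) 0 →
               Reaches c (λ d → At d seekN (+ suc k , ℤ.- + M) (B ∷ T ∷ []) 0)
    traverse here = reaches (suc (C ℕ.+ 1)) $
      carry {cnt = countS} refl (λ _ _ → refl) (λ _ → refl) reach land here
        (marked-∉ _ (embed-≢ (next-column k) ∷ []))
        (marked-∉ _ (embed-≢ (top≢bottom (suc k)) ∷ []))
      where
      reach : iterate (move S) (move E (bottom k)) C ≡ bottom (suc k)
      reach = trans (cong (λ v → iterate (move S) v C) (move-E k _))
                (trans (downward _ _ C) (cong (+ suc k ,_) (ℤₚ.neg-minus-pos K C)))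
      land : move N (bottom (suc k)) ≡ (+ suc k , ℤ.- + M)
      land = cong (+ suc k ,_) (solve 1 (λ m → :- (con (+ 1) :+ m) :+ con (+ 1) := :- m) refl (+ M))

    ascend : ∀ {c} → At c seekN (+ suc k , ℤ.- + M) (B ∷ T ∷ []) 0 →
             Reaches c (Ready (suc k)) × (∀ j → j ℕ.≤ M ℕ.+ M → Visited c (+ suc k , ℤ.- + M ℤ.+ + j))
    ascend here with walk refl (M ℕ.+ M) free here
      where
      below-top : ∀ j → j ℕ.< M ℕ.+ M → ℤ.- + M ℤ.+ + j ℤ.< + M
      below-top j j<m = subst (ℤ.- + M ℤ.+ + j ℤ.<_)
        (solve 1 (λ m → :- m :+ (m :+ m) := m) refl (+ M)) (ℤₚ.+-monoʳ-< (ℤ.- + M) (ℤ.+<+ j<m))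
      above-bottom : ∀ j → -[1+ M ] ℤ.< ℤ.- + M ℤ.+ + j
      above-bottom j = ℤₚ.<-≤-trans (ℤₚ.neg-mono-< (ℤ.+<+ (ℕₚ.n<1+n M))) (ℤₚ.i≤i+j (ℤ.- + M) (+ j))
      free : ∀ j → j ℕ.< M ℕ.+ M →
             marked (B ∷ T ∷ []) (embed (iterate (move N) (+ suc k , ℤ.- + M) j)) ≡ false
      free j j<m rewrite upward (+ suc k) (ℤ.- + M) j =
        marked-∉ _ (embed-≢ (≢-second (ℤₚ.<⇒≢ (above-bottom j)))
                  ∷ embed-≢ (≢-second (≢-sym (ℤₚ.<⇒≢ (below-top j j<m)))) ∷ [])
    ... | there , visits =
      reaches (M ℕ.+ M) (at-swap (embed-≢ (≢-sym (top≢bottom (suc k)))) (at-moved arrive there)) ,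
      λ j j≤m → subst (Visited _) (upward _ _ j) (visits j j≤m)
      where
      arrive : iterate (move N) (+ suc k , ℤ.- + M) (M ℕ.+ M) ≡ top (suc k)
      arrive = trans (upward _ _ (M ℕ.+ M))
        (cong (+ suc k ,_) (solve 1 (λ m → :- m :+ (m :+ m) := m) refl (+ M)))

    to-ascent : ∀ {c} → Ready k c → Reaches c (λ d → At d seekN (+ suc k , ℤ.- + M) (B ∷ T ∷ []) 0)
    to-ascent here =
      reaches-trans (climb here) λ climbed →
      reaches-trans (descend climbed) traverse

    next-ready : ∀ {c} → Ready k c → Reaches c (Ready (suc k))
    next-ready here = reaches-trans (to-ascent here) λ start → proj₁ (ascend start)

    column-visited : ∀ {c} → Ready k c → ∀ j → j ℕ.≤ M ℕ.+ M → Visited c (+ suc k , ℤ.- + M ℤ.+ + j)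
    column-visited here j j≤m = reaches-trans (to-ascent here) λ start → proj₂ (ascend start) j j≤m

  open Round using (next-ready; column-visited)

  ready : ∀ k → Reaches (start O) (Ready k)
  ready zero    = reaches 2 (at-swap (embed-≢ (≢-sym (top≢bottom 0))) (at-drop dropped-first
                    (marked-∉ _ (embed-≢ (top≢bottom 0) ∷ [])) refl))
    where
    dropped-first : At (step (start O)) dropBelow (bottom 0) (embed (top 0) ∷ []) 1
    dropped-first =
      at-drop {s = dropOrigin} {u = 0ℤ , 0ℤ} (at refl (sym embed-origin) (λ _ → refl) refl) refl refl
  ready (suc k) = reaches-trans (ready k) (next-ready k)

  private
    offset : ∀ M b → ℤ.- + M ℤ.≤ b → b ℤ.≤ + M → ∃ λ j → j ℕ.≤ M ℕ.+ M × b ≡ ℤ.- + M ℤ.+ + j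
    offset M b -M≤b b≤M = ℤ.∣ b ℤ.+ + M ∣ , j≤ , b≡
      where
      open ℤSolver.+-*-Solver
      0≤b+M : 0ℤ ℤ.≤ b ℤ.+ + M
      0≤b+M = subst (ℤ._≤ b ℤ.+ + M) (ℤₚ.+-inverseˡ (+ M)) (ℤₚ.+-monoˡ-≤ (+ M) -M≤b)
      j≡ : + ℤ.∣ b ℤ.+ + M ∣ ≡ b ℤ.+ + M
      j≡ = ℤₚ.0≤i⇒+∣i∣≡i 0≤b+M
      j≤ : ℤ.∣ b ℤ.+ + M ∣ ℕ.≤ M ℕ.+ M
      j≤ = ℤₚ.drop‿+≤+ (subst (ℤ._≤ + (M ℕ.+ M)) (sym j≡) (ℤₚ.+-monoˡ-≤ (+ M) b≤M))
      b≡ : b ≡ ℤ.- + M ℤ.+ + ℤ.∣ b ℤ.+ + M ∣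
      b≡ = trans (solve 2 (λ b m → b := :- m :+ (b :+ m)) refl b (+ M)) (cong (ℤ._+_ (ℤ.- + M)) (sym j≡))

  cone-visited : ∀ u → InCone C u → Visited (start O) u
  cone-visited _ (inj₁ (refl , refl)) = reaches 0 (sym embed-origin)
  cone-visited (_ , b) (inj₂ (k , refl , -M≤b , b≤M)) with offset (suc k ℕ.* C) b -M≤b b≤M
  ... | j , j≤ , refl = reaches-trans (ready k) λ here → column-visited k here j j≤

  explores-cone : ∀ u → InCone C u → Run.Visits (explorer F C) O (embed u)
  explores-cone u in-cone with cone-visited u in-cone
  ... | reaches n reached = n , trans (cong Config.pos (run≡ n)) reached
    where
    run≡ : ∀ n → run O n ≡ start O after n
    run≡ n = trans (run-is-fold n) (iterate-is-fold (start O) step n)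
      where
      run-is-fold : ∀ n → run O n ≡ fold (start O) step n
      run-is-fold zero    = refl
      run-is-fold (suc n) = cong step (run-is-fold n)

-- For half-lines in adjacent quadrants (s₁ , t₁) and (s₂ , t₂), the sign conditions of
-- Counterclockwise make both terms of cross d₁ d₂ positive.
Clockwise Counterclockwise : Sgn → Sgn → Sgn → Sgn → Set
Clockwise s₁ t₁ s₂ t₂ =
  ∃ λ k → iterate turnᵠ (s₁ , t₁) k ≡ (plus , plus) × iterate turnᵠ (s₂ , t₂) k ≡ (plus , minus)
Counterclockwise s₁ t₁ s₂ t₂ = s₁ *ˢ t₂ ≡ plus × t₁ *ˢ s₂ ≡ minus

≢⇒negate : ∀ {s t} → s ≢ t → t ≡ negate s
≢⇒negate {plus}  {plus}  s≢t = ⊥-elim (s≢t refl)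
≢⇒negate {plus}  {minus} _   = refl
≢⇒negate {minus} {plus}  _   = refl
≢⇒negate {minus} {minus} s≢t = ⊥-elim (s≢t refl)

adjacent-orientation : ∀ s₁ t₁ s₂ t₂ → (s₁ ≡ s₂ × t₁ ≢ t₂) ⊎ (s₁ ≢ s₂ × t₁ ≡ t₂) →
                       Clockwise s₁ t₁ s₂ t₂ ⊎ Counterclockwise s₁ t₁ s₂ t₂
adjacent-orientation s₁ t₁ s₂ t₂ (inj₁ (refl , t₁≢t₂)) rewrite ≢⇒negate t₁≢t₂ = vertical s₁ t₁
  where
  vertical : ∀ s t → Clockwise s t s (negate t) ⊎ Counterclockwise s t s (negate t)
  vertical plus  plus  = inj₁ (0 , refl , refl)
  vertical plus  minus = inj₂ (refl , refl)
  vertical minus plus  = inj₂ (refl , refl)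
  vertical minus minus = inj₁ (2 , refl , refl)
adjacent-orientation s₁ t₁ s₂ t₂ (inj₂ (s₁≢s₂ , refl)) rewrite ≢⇒negate s₁≢s₂ = horizontal s₁ t₁
  where
  horizontal : ∀ s t → Clockwise s t (negate s) t ⊎ Counterclockwise s t (negate s) t
  horizontal plus  plus  = inj₂ (refl , refl)
  horizontal minus plus  = inj₁ (1 , refl , refl)
  horizontal plus  minus = inj₁ (3 , refl , refl)
  horizontal minus minus = inj₂ (refl , refl)

explores-clockwise-wedge : ∀ O k {d₁ d₂ q₁ q₂} → TightEncl d₁ q₁ → TightEncl d₂ q₂ →
  iterate turnᵠ q₁ k ≡ (plus , plus) → iterate turnᵠ q₂ k ≡ (plus , minus) →
  Σ (Automaton 2) λ A → Explores A O (InSmallWedge O d₁ d₂)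
explores-clockwise-wedge O k {d₁} {d₂} T₁ T₂ q₁≡ q₂≡ with wedge-in-cone k O T₁ T₂ q₁≡ q₂≡
... | C , in-cone = explorer (rotated O k) C , explores
  where
  explores : Explores (explorer (rotated O k) C) O (InSmallWedge O d₁ d₂)
  explores x in-wedge with rotated-surjective O k x
  ... | u , refl = Exploration.explores-cone (rotated O k) C u (in-cone u in-wedge)

lemma6 : (O : ℤ²) (d₁ d₂ : ℝ²) →
         Small d₁ d₂ → AdjacentQuadrants d₁ d₂ →
         Σ (Automaton 2) λ A → Explores A O (InSmallWedge O d₁ d₂)
lemma6 O (x₁ , y₁) (x₂ , y₂) small (s₁ , t₁ , s₂ , t₂ , q₁ , q₂ , adjacent)
  with adjacent-orientation s₁ t₁ s₂ t₂ adjacent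
... | inj₁ (k , q₁≡ , q₂≡) =
  explores-clockwise-wedge O k (tight-encl x₁ y₁ s₁ t₁ q₁) (tight-encl x₂ y₂ s₂ t₂ q₂) q₁≡ q₂≡
... | inj₂ (s₁t₂≡ , t₁s₂≡) =
  ⊥-elim (counterclockwise-not-small x₁ y₁ x₂ y₂ s₁ t₁ s₂ t₂ s₁t₂≡ t₁s₂≡ q₁ q₂ small)
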